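{- Let $X$, GreedyArb, $j,k,P$ and the notions hidden/exposed be as in the context. For $p\in P$, let $N(p)$ be the number of integers $t$ with $p.y<t\le n$ such that $p$ is hidden at time $t$ and exposed at time $t+1$, or exposed at time $t$ and hidden at time $t+1$. Then $\sum_{p\in P}N(p)\le 5k$; that is, the total number of times the points of $P$ change their state from hidden to exposed or vice versa is at most $5k$.
   Context: Let $n\ge1$ and $X=\{p_1,\dots,p_n\}\subset\mathbb{Z}^2$ with $p_i=(i,t_i)$, where $(t_1,\dots,t_n)$ is a permutation of $\{1,\dots,n\}$; $a.x,a.y$ denote the coordinates of a point $a$. For points $a,b$ not on a common horizontal or vertical line, $\Box ab$ is the closed axis-parallel rectangle with opposite corners $a,b$. GreedyArb: for $t=1,\dots,n$ in order, let $p$ be the point of $X$ with $p.y=t$ and let $Z_t$ be the set of points of $X$ with $y$-coordinate $<t$ together with all points added at earlier steps; add $M_p=\{(q.x,t): q\in Z_t,\ q.x\ne p.x,\ \Box pq\text{ contains no point of }Z_t\cup\{p\}\text{ other than }p,q\}$. Let $Y=\bigcup_{p\in X}M_p$. Fix integers $j,k\ge1$ with $j+2k-1\le n$. Let $P=\{p_j,\dots,p_{j+k-1}\}$ and $R_P=\{(x,y): j-\tfrac12<x<j+k-\tfrac12\}$. For $p\in P$ and an integer $t>p.y$, let $T^p_{<t}$ be the set of points of $X\cup Y$ on the line $x=p.x$ with $y$-coordinate $<t$, and let $r$ be the point of $T^p_{<t}$ with largest $y$-coordinate. The point $p$ is hidden at time $t$ if there exist points of $X\cup Y$ in $R_P$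 on the line $y=r.y$, one with $x$-coordinate $<r.x$ and one with $x$-coordinate $>r.x$; otherwise $p$ is exposed at time $t$. -}

module Defs where

open import Data.Nat.Base using (ℕ; zero; suc; _+_; _∸_; _⊔_; _⊓_; _≡ᵇ_; _<ᵇ_; _≤ᵇ_)
open import Data.Bool.Base using (Bool; true; false; _∧_; _∨_; not; _xor_; if_then_else_)
open import Data.List.Base using (List; []; _∷_; _++_; map; filterᵇ; concatMap; upTo; foldr; length)
open import Data.Bool.ListAction using (any; all)
open import Data.Nat.ListAction using (sum)
open import Data.Product.Base using (_×_; _,_; proj₁; proj₂)

Point : Set
Point = ℕ × ℕ

px : Point → ℕ
px = proj₁

py : Point → ℕ
py = proj₂

_≡ₚ_ : Point → Point → Bool
a ≡ₚ b = (px a ≡ᵇ px b) ∧ (py a ≡ᵇ py b)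

inBox : Point → Point → Point → Bool
inBox p q r =
  ((px p ⊓ px q) ≤ᵇ px r) ∧ (px r ≤ᵇ (px p ⊔ px q)) ∧
  ((py p ⊓ py q) ≤ᵇ py r) ∧ (py r ≤ᵇ (py p ⊔ py q))

-- M_p for the current set Z (= Z_t, with t = p.y):
-- points (q.x, p.y) for q ∈ Z with q.x ≠ p.x and □pq containing no point
-- of Z ∪ {p} other than p, q.
Mset : Point → List Point → List Point
Mset p Z =
  map (λ q → (px q , py p))
      (filterᵇ (λ q → not (px q ≡ᵇ px p) ∧
                       all (λ r → (r ≡ₚ q) ∨ (r ≡ₚ p) ∨ not (inBox p q r)) Z)
               Z)

-- The input: a function t with p_i = (i , t i) for i = 1..n
-- (values of t outside 1..n are irrelevant).
module Greedy (n : ℕ) (t : ℕ → ℕ) where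

  pt : ℕ → Point
  pt i = (i , t i)

  Xs : List Point
  Xs = map (λ i → pt (suc i)) (upTo n)

  -- the point(s) of X on row s (exactly one when t is a permutation)
  rowPts : ℕ → List Point
  rowPts s = filterᵇ (λ p → py p ≡ᵇ s) Xs

  -- Zs m = Z_{m+1}: the points of X with y ≤ m together with all points
  -- added by GreedyArb in steps 1..m.
  Zs : ℕ → List Point
  Zs zero = []
  Zs (suc m) = Zs m ++ concatMap (λ p → p ∷ Mset p (Zs m)) (rowPts (suc m))

  XY : List Point
  XY = Zs n

  module Window (j k : ℕ) where

    inR : Point → Bool
    inR a = (j ≤ᵇ px a) ∧ (px a <ᵇ j + k)

    Tcol : Point → ℕ → List Point
    Tcol p s = filterᵇ (λ a → (px a ≡ᵇ px p) ∧ (py a <ᵇ s)) XY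

    -- r.y, the largest y-coordinate in T^p_{<t}  (r.x = p.x)
    ry : Point → ℕ → ℕ
    ry p s = foldr (λ a m → py a ⊔ m) 0 (Tcol p s)

    hidden : Point → ℕ → Bool
    hidden p s =
      any (λ a → (py a ≡ᵇ ry p s) ∧ inR a ∧ (px a <ᵇ px p)) XY ∧
      any (λ a → (py a ≡ᵇ ry p s) ∧ inR a ∧ (px p <ᵇ px a)) XY

    N : Point → ℕ
    N p = length (filterᵇ (λ s → hidden p s xor hidden p (suc s))
                          (map (λ i → suc (py p) + i) (upTo (n ∸ py p))))

    totalN : ℕ
    totalN = sum (map (λ i → N (pt (j + i))) (upTo k))

-- A point p of P can change state only at a time s at which a point of X ∪ Y appears at (p.x, s): otherwise
-- the top r of its column stays the same. If p turns from hidden to exposed at time s → s+1, the new point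
-- (p.x, s) lies between two points of row r in R_P. It was added by the point p′ of X on row s through an
-- empty rectangle, so p′.x lies strictly between them too and p′ ∈ P; and as p is exposed at s+1, (p.x, s)
-- is the leftmost or the rightmost point of X ∪ Y in R_P on row s. So the points of P turn from hidden to
-- exposed at most 2k times in total, at most twice per row of a point of P. In each column the changes
-- alternate between the two directions, hence N(p) ≤ 2·(hidden-to-exposed changes of p) + 1 and
-- ∑ N(p) ≤ 2·2k + k = 5k.

module Submission where

open import Defs
open import Data.Bool.Base using (Bool; true; false; T; _∧_; _∨_; not; _xor_)
open import Data.Bool.ListAction using (any)
open import Data.Bool.Properties using (T-∧; T-∨; T-≡)
open import Data.Empty using (⊥-elim)
open import Data.List.Base using (List; []; _∷_; concatMap; filterᵇ; applyUpTo; length; foldr)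
open import Data.List.Membership.Propositional using (_∈_; _∉_; find; lose)
open import Data.List.Membership.Propositional.Properties
  using (∈-map⁻; ∈-++⁻; ∈-++⁺ˡ; ∈-concatMap⁻; ∈-filter⁻; ∈-filter⁺)
open import Data.List.Properties using (map-applyUpTo)
open import Data.List.Relation.Unary.All using (lookup)
open import Data.List.Relation.Unary.All.Properties using (all⁺)
open import Data.List.Relation.Unary.Any using (here; there)
open import Data.List.Relation.Unary.Any.Properties using (any⁺; any⁻)
open import Data.Nat.Base
open import Data.Nat.ListAction using (sum)
open import Data.Nat.Properties
open import Data.Nat.Tactic.RingSolver using (solve-∀)
open import Data.Product.Base using (_×_; _,_; proj₁; proj₂; ∃)
open import Data.Product.Properties using (≡-dec)
open import Data.Sum.Base using (_⊎_; inj₁; inj₂)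
open import Function.Base using (_∘_; id)
open import Function.Bundles using (Equivalence)
open import Relation.Nullary using (¬_; yes; no; T?)
open import Relation.Binary.PropositionalEquality
open import Data.List.Membership.DecPropositional (≡-dec _≟_ _≟_) using (_∈?_)
open import Algebra.Properties.CommutativeSemigroup +-commutativeSemigroup using (interchange; xy∙z≈xz∙y)

private
  variable
    A : Set

T-∧⁻ : ∀ {x y} → T (x ∧ y) → T x × T y
T-∧⁻ {x} = Equivalence.to (T-∧ {x})

T-∧⁺ : ∀ {x y} → T x → T y → T (x ∧ y)
T-∧⁺ {x} tx ty = Equivalence.from (T-∧ {x}) (tx , ty)

T-not⁻ : ∀ {x} → T (not x) → ¬ T x
T-not⁻ {false} _ ()

T-not⁺ : ∀ {x} → ¬ T x → T (not x)
T-not⁺ {false} _   = _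
T-not⁺ {true}  ¬tx = ¬tx _

toℕ : Bool → ℕ
toℕ false = 0
toℕ true  = 1

toℕ≤1 : ∀ b → toℕ b ≤ 1
toℕ≤1 false = z≤n
toℕ≤1 true  = ≤-refl

T⇒1≤toℕ : ∀ {b} → T b → 1 ≤ toℕ b
T⇒1≤toℕ {true} _ = ≤-refl

toℕ-∨≤ : ∀ x y → toℕ (x ∨ y) ≤ toℕ x + toℕ y
toℕ-∨≤ true  y = s≤s z≤n
toℕ-∨≤ false y = ≤-refl

∑ : ℕ → (ℕ → ℕ) → ℕ
∑ zero    f = 0
∑ (suc m) f = ∑ m f + f m

syntax ∑ m (λ i → e) = ∑[ i < m ] e

∑-unfoldˡ : ∀ m f → ∑ (suc m) f ≡ f 0 + ∑ m (f ∘ suc)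
∑-unfoldˡ zero    f = +-comm 0 (f 0)
∑-unfoldˡ (suc m) f = trans (cong (_+ f (suc m)) (∑-unfoldˡ m f)) (+-assoc (f 0) _ _)

sum-applyUpTo : ∀ f m → sum (applyUpTo f m) ≡ ∑ m f
sum-applyUpTo f zero    = refl
sum-applyUpTo f (suc m) = trans (cong (f 0 +_) (sum-applyUpTo (f ∘ suc) m)) (sym (∑-unfoldˡ m f))

length-filterᵇ-∷ : ∀ (p : A → Bool) x xs →
  length (filterᵇ p (x ∷ xs)) ≡ toℕ (p x) + length (filterᵇ p xs)
length-filterᵇ-∷ p x xs with p x
... | true  = refl
... | false = refl

length-filterᵇ-applyUpTo : ∀ (p : A → Bool) f m →
  length (filterᵇ p (applyUpTo f m)) ≡ ∑[ i < m ] toℕ (p (f i))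
length-filterᵇ-applyUpTo p f zero    = refl
length-filterᵇ-applyUpTo p f (suc m) = begin
  length (filterᵇ p (applyUpTo f (suc m)))
    ≡⟨ length-filterᵇ-∷ p (f 0) _ ⟩
  toℕ (p (f 0)) + length (filterᵇ p (applyUpTo (f ∘ suc) m))
    ≡⟨ cong (toℕ (p (f 0)) +_) (length-filterᵇ-applyUpTo p (f ∘ suc) m) ⟩
  toℕ (p (f 0)) + ∑[ i < m ] toℕ (p (f (suc i)))
    ≡⟨ ∑-unfoldˡ m (λ i → toℕ (p (f i))) ⟨
  ∑[ i < suc m ] toℕ (p (f i)) ∎
  where open ≡-Reasoning

∑-mono-≤ : ∀ m {f g} → (∀ i → i < m → f i ≤ g i) → ∑ m f ≤ ∑ m g
∑-mono-≤ zero    f≤g = z≤n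
∑-mono-≤ (suc m) f≤g = +-mono-≤ (∑-mono-≤ m (λ i i<m → f≤g i (m<n⇒m<1+n i<m))) (f≤g m ≤-refl)

∑-distrib-+ : ∀ m f g → ∑[ i < m ] (f i + g i) ≡ ∑ m f + ∑ m g
∑-distrib-+ zero    f g = refl
∑-distrib-+ (suc m) f g =
  trans (cong (_+ (f m + g m)) (∑-distrib-+ m f g)) (interchange (∑ m f) (∑ m g) (f m) (g m))

∑-*ˡ : ∀ m c f → ∑[ i < m ] (c * f i) ≡ c * ∑ m f
∑-*ˡ zero    c f = sym (*-zeroʳ c)
∑-*ˡ (suc m) c f = trans (cong (_+ c * f m) (∑-*ˡ m c f)) (sym (*-distribˡ-+ c (∑ m f) (f m)))

∑-const : ∀ m c → ∑[ _ < m ] c ≡ m * c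
∑-const zero    c = refl
∑-const (suc m) c = trans (cong (_+ c) (∑-const m c)) (+-comm (m * c) c)

∑-comm : ∀ m k (g : ℕ → ℕ → ℕ) → ∑[ a < m ] ∑[ b < k ] g a b ≡ ∑[ b < k ] ∑[ a < m ] g a b
∑-comm m zero    g = trans (∑-const m 0) (*-zeroʳ m)
∑-comm m (suc k) g = trans (∑-distrib-+ m _ _) (cong (_+ ∑[ a < m ] g a k) (∑-comm m k g))

∑-split : ∀ a m f → ∑ (a + m) f ≡ ∑ a f + ∑[ u < m ] f (a + u)
∑-split a zero    f = trans (cong (λ x → ∑ x f) (+-identityʳ a)) (sym (+-identityʳ (∑ a f)))
∑-split a (suc m) f = begin
  ∑ (a + suc m) f                          ≡⟨ cong (λ x → ∑ x f) (+-suc a m) ⟩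
  ∑ (a + m) f + f (a + m)                  ≡⟨ cong (_+ f (a + m)) (∑-split a m f) ⟩
  ∑ a f + ∑[ u < m ] f (a + u) + f (a + m) ≡⟨ +-assoc (∑ a f) _ _ ⟩
  ∑ a f + ∑[ u < suc m ] f (a + u)         ∎
  where open ≡-Reasoning

∑-shift-≤ : ∀ a m f → ∑[ u < m ] f (a + u) ≤ ∑ (a + m) f
∑-shift-≤ a m f = ≤-trans (m≤n+m _ (∑ a f)) (≤-reflexive (sym (∑-split a m f)))

∑-toℕ-≡0 : ∀ m (p : ℕ → Bool) → (∀ i → i < m → ¬ T (p i)) → ∑[ i < m ] toℕ (p i) ≡ 0
∑-toℕ-≡0 zero    p none = refl
∑-toℕ-≡0 (suc m) p none with p m in pm
... | true  = ⊥-elim (none m ≤-refl (Equivalence.from T-≡ pm))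
... | false = trans (+-identityʳ _) (∑-toℕ-≡0 m p (λ i i<m → none i (m<n⇒m<1+n i<m)))

∑-toℕ-≤1 : ∀ m (p : ℕ → Bool) → (∀ {x y} → T (p x) → T (p y) → x ≡ y) → ∑[ i < m ] toℕ (p i) ≤ 1
∑-toℕ-≤1 zero    p unique = z≤n
∑-toℕ-≤1 (suc m) p unique with p m in pm
... | false = subst (_≤ 1) (sym (+-identityʳ _)) (∑-toℕ-≤1 m p unique)
... | true  = ≤-reflexive (cong (_+ 1) (∑-toℕ-≡0 m p others-false))
  where
  others-false : ∀ i → i < m → ¬ T (p i)
  others-false i i<m pi = <-irrefl (unique pi (Equivalence.from T-≡ pm)) i<m

∑-toℕ-∧-≤ : ∀ m b (p : ℕ → Bool) → (∀ {x y} → T (p x) → T (p y) → x ≡ y) →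
  ∑[ i < m ] toℕ (b ∧ p i) ≤ toℕ b
∑-toℕ-∧-≤ m false p unique = ≤-reflexive (∑-toℕ-≡0 m (λ _ → false) (λ _ _ ()))
∑-toℕ-∧-≤ m true  p unique = ∑-toℕ-≤1 m p unique

any< : ℕ → (ℕ → Bool) → Bool
any< zero    p = false
any< (suc m) p = any< m p ∨ p m

any<⁺ : ∀ m p {i} → i < m → T (p i) → T (any< m p)
any<⁺ (suc m) p {i} i<1+m pi with m≤n⇒m<n∨m≡n (≤-pred i<1+m)
... | inj₁ i<m  = Equivalence.from T-∨ (inj₁ (any<⁺ m p i<m pi))
... | inj₂ refl = Equivalence.from (T-∨ {any< m p}) (inj₂ pi)

toℕ-any<≤∑ : ∀ m p → toℕ (any< m p) ≤ ∑[ i < m ] toℕ (p i)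
toℕ-any<≤∑ zero    p = z≤n
toℕ-any<≤∑ (suc m) p = ≤-trans (toℕ-∨≤ (any< m p) (p m)) (+-monoˡ-≤ _ (toℕ-any<≤∑ m p))

∑-toℕ-image≤ : ∀ M k (f : ℕ → ℕ) → ∑[ s < M ] toℕ (any< k (λ i → f i ≡ᵇ s)) ≤ k
∑-toℕ-image≤ M k f = begin
  ∑[ s < M ] toℕ (any< k (λ i → f i ≡ᵇ s)) ≤⟨ ∑-mono-≤ M (λ s _ → toℕ-any<≤∑ k _) ⟩
  ∑[ s < M ] ∑[ i < k ] toℕ (f i ≡ᵇ s)      ≡⟨ ∑-comm M k _ ⟩
  ∑[ i < k ] ∑[ s < M ] toℕ (f i ≡ᵇ s)      ≤⟨ ∑-mono-≤ k (λ i _ → ∑-toℕ-≤1 M _ (value-unique i)) ⟩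
  ∑[ _ < k ] 1                              ≡⟨ trans (∑-const k 1) (*-identityʳ k) ⟩
  k                                         ∎
  where
  open ≤-Reasoning
  value-unique : ∀ i {x y} → T (f i ≡ᵇ x) → T (f i ≡ᵇ y) → x ≡ y
  value-unique i {x} {y} fx fy = trans (sym (≡ᵇ⇒≡ (f i) x fx)) (≡ᵇ⇒≡ (f i) y fy)

changes falls : (ℕ → Bool) → ℕ → ℕ → ℕ
changes h a m = ∑[ u < m ] toℕ (h (a + u) xor h (suc (a + u)))
falls   h a m = ∑[ u < m ] toℕ (h (a + u) ∧ not (h (suc (a + u))))

-- Rises and falls alternate, so the number of rises is the number of falls corrected by the end states.
changes-alternate : ∀ h a m → changes h a m + toℕ (h a) ≡ 2 * falls h a m + toℕ (h (a + m))
changes-alternate h a zero    = cong (λ x → toℕ (h x)) (sym (+-identityʳ a))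
changes-alternate h a (suc m) = begin
  changes h a m + toℕ (u xor v) + toℕ (h a)   ≡⟨ xy∙z≈xz∙y (changes h a m) _ _ ⟩
  changes h a m + toℕ (h a) + toℕ (u xor v)   ≡⟨ cong (_+ toℕ (u xor v)) (changes-alternate h a m) ⟩
  2 * F + toℕ u + toℕ (u xor v)               ≡⟨ +-assoc (2 * F) _ _ ⟩
  2 * F + (toℕ u + toℕ (u xor v))             ≡⟨ cong (2 * F +_) (step u v) ⟩
  2 * F + (2 * toℕ (u ∧ not v) + toℕ v)       ≡⟨ +-assoc (2 * F) _ _ ⟨
  2 * F + 2 * toℕ (u ∧ not v) + toℕ v         ≡⟨ cong (_+ toℕ v) (*-distribˡ-+ 2 F _) ⟨
  2 * falls h a (suc m) + toℕ v               ≡⟨ cong (λ x → 2 * falls h a (suc m) + toℕ (h x)) (+-suc a m) ⟨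
  2 * falls h a (suc m) + toℕ (h (a + suc m)) ∎
  where
  open ≡-Reasoning
  F = falls h a m
  u = h (a + m)
  v = h (suc (a + m))
  step : ∀ u v → toℕ u + toℕ (u xor v) ≡ 2 * toℕ (u ∧ not v) + toℕ v
  step true  true  = refl
  step true  false = refl
  step false true  = refl
  step false false = refl

changes≤2*falls+1 : ∀ h a m → changes h a m ≤ 2 * falls h a m + 1
changes≤2*falls+1 h a m = begin
  changes h a m                          ≤⟨ m≤m+n _ (toℕ (h a)) ⟩
  changes h a m + toℕ (h a)              ≡⟨ changes-alternate h a m ⟩
  2 * falls h a m + toℕ (h (a + m))      ≤⟨ +-monoʳ-≤ _ (toℕ≤1 _) ⟩
  2 * falls h a m + 1                    ∎
  where open ≤-Reasoning

foldr-⊔-ub : ∀ (f : A → ℕ) L {a} → a ∈ L → f a ≤ foldr (λ b m → f b ⊔ m) 0 L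
foldr-⊔-ub f (b ∷ L) (here refl) = m≤m⊔n (f b) _
foldr-⊔-ub f (b ∷ L) (there a∈L) = ≤-trans (foldr-⊔-ub f L a∈L) (m≤n⊔m (f b) _)

foldr-⊔-lub : ∀ (f : A → ℕ) L {m} → (∀ {a} → a ∈ L → f a ≤ m) → foldr (λ b m → f b ⊔ m) 0 L ≤ m
foldr-⊔-lub f []      ub = z≤n
foldr-⊔-lub f (b ∷ L) ub = ⊔-lub (ub (here refl)) (foldr-⊔-lub f L (ub ∘ there))

Between : ℕ → ℕ → ℕ → Set
Between x y z = y ⊓ z ≤ x × x ≤ y ⊔ z

-- The part of "□pq contains no point of Z other than p, q" that is used: points on the rows from q up to,
-- but excluding, p.
EmptyBox : Point → Point → List Point → Set
EmptyBox p q Z = ∀ {r} → r ∈ Z → px r ≢ px q → py q ≤ py r → py r < py p → ¬ Between (px r) (px p) (px q)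

emptyBox-left : ∀ {p q Z r} → EmptyBox p q Z → r ∈ Z →
  px r < px q → py q ≤ py r → py r < py p → px r < px p
emptyBox-left {p} {q} empty r∈Z r<q q≤r r<p = ≰⇒> λ p≤r →
  empty r∈Z (<⇒≢ r<q) q≤r r<p (m≤n⇒m⊓o≤n (px q) p≤r , m≤n⇒m≤o⊔n (px p) (<⇒≤ r<q))

emptyBox-right : ∀ {p q Z r} → EmptyBox p q Z → r ∈ Z →
  px q < px r → py q ≤ py r → py r < py p → px p < px r
emptyBox-right {p} {q} empty r∈Z q<r q≤r r<p = ≰⇒> λ r≤p →
  empty r∈Z (≢-sym (<⇒≢ q<r)) q≤r r<p (m≤n⇒o⊓m≤n (px p) (<⇒≤ q<r) , m≤n⇒m≤n⊔o (px q) r≤p)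

Mset-emptyBox : ∀ p Z {a} → a ∈ Mset p Z → ∃ λ q → q ∈ Z × a ≡ (px q , py p) × EmptyBox p q Z
Mset-emptyBox p Z a∈M with ∈-map⁻ (λ q → (px q , py p)) a∈M
... | q , q∈M , refl with ∈-filter⁻ (T? ∘ _) {xs = Z} q∈M
... | q∈Z , admissible = q , q∈Z , refl , empty
  where
  box-free = lookup (all⁺ _ Z (proj₂ (T-∧⁻ admissible)))
  empty : EmptyBox p q Z
  empty {r} r∈Z r≢q q≤r r<p (lo , hi) with Equivalence.to T-∨ (box-free r∈Z)
  ... | inj₁ r≡q = r≢q (≡ᵇ⇒≡ _ _ (proj₁ (T-∧⁻ r≡q)))
  ... | inj₂ rest with Equivalence.to T-∨ rest
  ...   | inj₁ r≡p   = <-irrefl (≡ᵇ⇒≡ _ _ (proj₂ (T-∧⁻ {px r ≡ᵇ px p} r≡p))) r<p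
  ...   | inj₂ ¬inBox = T-not⁻ ¬inBox
          (T-∧⁺ (≤⇒≤ᵇ lo) (T-∧⁺ (≤⇒≤ᵇ hi)
            (T-∧⁺ (≤⇒≤ᵇ (m≤n⇒o⊓m≤n (py p) q≤r)) (≤⇒≤ᵇ (m≤n⇒m≤n⊔o (py q) (<⇒≤ r<p))))))

module GreedyArb (n : ℕ) (t : ℕ → ℕ) where
  open Greedy n t

  newPts : ℕ → List Point
  newPts m = concatMap (λ p → p ∷ Mset p (Zs m)) (rowPts (suc m))

  rowPts-mem : ∀ {s p} → p ∈ rowPts s → py p ≡ s × t (px p) ≡ s
  rowPts-mem {s} p∈ with ∈-filter⁻ (T? ∘ (λ p → py p ≡ᵇ s)) {xs = Xs} p∈
  ... | p∈X , ps with ∈-map⁻ (λ i → pt (suc i)) p∈X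
  ... | i , _ , refl = ≡ᵇ⇒≡ _ _ ps , ≡ᵇ⇒≡ _ _ ps

  newPts-origin : ∀ {s a} → a ∈ newPts s →
    ∃ λ p → p ∈ rowPts (suc s) × (a ≡ p ⊎ a ∈ Mset p (Zs s))
  newPts-origin {s} a∈ with find (∈-concatMap⁻ (λ p → p ∷ Mset p (Zs s)) {xs = rowPts (suc s)} a∈)
  ... | p , p∈ , here a≡p  = p , p∈ , inj₁ a≡p
  ... | p , p∈ , there a∈M = p , p∈ , inj₂ a∈M

  newPts-py : ∀ {s a} → a ∈ newPts s → py a ≡ suc s
  newPts-py {s} a∈ with newPts-origin a∈
  ... | p , p∈ , inj₁ refl = proj₁ (rowPts-mem p∈)
  ... | p , p∈ , inj₂ a∈M with Mset-emptyBox p (Zs s) a∈M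
  ...   | _ , _ , refl , _ = proj₁ (rowPts-mem p∈)

  Zs-py : ∀ m {a} → a ∈ Zs m → py a ≤ m
  Zs-py (suc m) a∈ with ∈-++⁻ (Zs m) a∈
  ... | inj₁ a∈Z = m≤n⇒m≤1+n (Zs-py m a∈Z)
  ... | inj₂ a∈N = ≤-reflexive (newPts-py a∈N)

  Zs-mono : ∀ {m} m′ {a} → m ≤ m′ → a ∈ Zs m → a ∈ Zs m′
  Zs-mono zero     z≤n a∈ = a∈
  Zs-mono (suc m′) m≤  a∈ with m≤n⇒m<n∨m≡n m≤
  ... | inj₁ m<    = ∈-++⁺ˡ (Zs-mono m′ (≤-pred m<) a∈)
  ... | inj₂ refl  = a∈

  Zs-restrict : ∀ m′ {m a} → a ∈ Zs m′ → py a ≤ m → a ∈ Zs m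
  Zs-restrict (suc m′) a∈ a≤m with ∈-++⁻ (Zs m′) a∈
  ... | inj₁ a∈Z = Zs-restrict m′ a∈Z a≤m
  ... | inj₂ a∈N = Zs-mono _ (subst (_≤ _) (newPts-py a∈N) a≤m) a∈

  XY-row : ∀ {s a} → a ∈ XY → py a ≡ suc s → a ∈ newPts s
  XY-row {s} a∈ a-row with ∈-++⁻ (Zs s) (Zs-restrict n a∈ (≤-reflexive a-row))
  ... | inj₁ a∈Z = ⊥-elim (<-irrefl a-row (s≤s (Zs-py s a∈Z)))
  ... | inj₂ a∈N = a∈N

  -- A point (c , s+1) of X ∪ Y is either the point p of X on row s+1 or lies in M_p, coming from some q in
  -- column c; then □pq is empty, so p lies strictly between any two points of Z_s flanking column c on a row
  -- at or above q.
  producer-between : ∀ {s c r a b} → (c , suc s) ∈ XY →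
    (∀ {q} → q ∈ Zs s → px q ≡ c → py q ≤ r) →
    a ∈ Zs s → b ∈ Zs s → py a ≡ r → py b ≡ r → px a < c → c < px b →
    ∃ λ p → p ∈ rowPts (suc s) × px a < px p × px p < px b
  producer-between {s} {r = r} {a} {b} new below a∈ b∈ a-row b-row a<c c<b
    with newPts-origin (XY-row new refl)
  ... | p , p∈ , inj₁ refl = p , p∈ , a<c , c<b
  ... | p , p∈ , inj₂ c∈M with Mset-emptyBox p (Zs s) c∈M
  ...   | q , q∈ , refl , empty =
    p , p∈ , emptyBox-left {p} {q} {Zs s} empty a∈ a<c (q-below a a-row) (below-p a∈) ,
             emptyBox-right {p} {q} {Zs s} empty b∈ c<b (q-below b b-row) (below-p b∈)
    where
    q-below : ∀ x → py x ≡ r → py q ≤ py x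
    q-below _ x-row = subst (py q ≤_) (sym x-row) (below q∈ refl)
    below-p : ∀ {x} → x ∈ Zs s → py x < py p
    below-p {x} x∈ = subst (py x <_) (sym (proj₁ (rowPts-mem p∈))) (s≤s (Zs-py s x∈))

  module Strip (j k : ℕ) where
    open Window j k

    InStrip : ℕ → Set
    InStrip x = j ≤ x × x < j + k

    rowHas : ℕ → (ℕ → Bool) → Bool
    rowHas s φ = any (λ a → (py a ≡ᵇ s) ∧ inR a ∧ φ (px a)) XY

    -- hidden p s is, by definition, flanked (px p) (ry p s).
    flanked : ℕ → ℕ → Bool
    flanked c r = rowHas r (_<ᵇ c) ∧ rowHas r (c <ᵇ_)

    leftmost rightmost : ℕ → ℕ → Bool
    leftmost  c s = rowHas s (_≡ᵇ c) ∧ not (rowHas s (_<ᵇ c))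
    rightmost c s = rowHas s (_≡ᵇ c) ∧ not (rowHas s (c <ᵇ_))

    rowOfP : ℕ → Bool
    rowOfP s = any< k (λ i → t (j + i) ≡ᵇ s)

    rowHas⁻ : ∀ {s φ} → T (rowHas s φ) →
      ∃ λ a → a ∈ XY × py a ≡ s × InStrip (px a) × T (φ (px a))
    rowHas⁻ {s} has with find (any⁻ _ XY has)
    ... | a , a∈ , sat with T-∧⁻ sat
    ...   | a-row , rest with T-∧⁻ rest
    ...     | strip , φa with T-∧⁻ strip
    ...       | j≤a , a<jk = a , a∈ , ≡ᵇ⇒≡ _ _ a-row , (≤ᵇ⇒≤ _ _ j≤a , <ᵇ⇒< _ _ a<jk) , φa

    rowHas⁺ : ∀ {a φ} → a ∈ XY → InStrip (px a) → T (φ (px a)) → T (rowHas (py a) φ)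
    rowHas⁺ {a} a∈ (j≤a , a<jk) φa =
      any⁺ _ (lose a∈ (T-∧⁺ (≡⇒≡ᵇ (py a) _ refl) (T-∧⁺ (T-∧⁺ (≤⇒≤ᵇ j≤a) (<⇒<ᵇ a<jk)) φa)))

    rowHas-mono : ∀ {s φ ψ} → (∀ {x} → T (φ x) → T (ψ x)) → T (rowHas s φ) → T (rowHas s ψ)
    rowHas-mono φ⇒ψ has with rowHas⁻ has
    ... | a , a∈ , refl , strip , φa = rowHas⁺ a∈ strip (φ⇒ψ φa)

    occupied-left : ∀ {s x y} → T (rowHas s (_≡ᵇ y)) → y < x → T (rowHas s (_<ᵇ x))
    occupied-left {y = y} occ y<x =
      rowHas-mono (λ {z} z≡y → <⇒<ᵇ (subst (_< _) (sym (≡ᵇ⇒≡ z y z≡y)) y<x)) occ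

    occupied-right : ∀ {s x y} → T (rowHas s (_≡ᵇ y)) → x < y → T (rowHas s (x <ᵇ_))
    occupied-right {y = y} occ x<y =
      rowHas-mono (λ {z} z≡y → <⇒<ᵇ (subst (_ <_) (sym (≡ᵇ⇒≡ z y z≡y)) x<y)) occ

    leftmost-unique : ∀ {s x y} → T (leftmost x s) → T (leftmost y s) → x ≡ y
    leftmost-unique lx ly with T-∧⁻ lx | T-∧⁻ ly
    ... | occ-x , free-x | occ-y , free-y =
      ≤-antisym (≮⇒≥ (T-not⁻ free-x ∘ occupied-left occ-y)) (≮⇒≥ (T-not⁻ free-y ∘ occupied-left occ-x))

    rightmost-unique : ∀ {s x y} → T (rightmost x s) → T (rightmost y s) → x ≡ y
    rightmost-unique rx ry with T-∧⁻ rx | T-∧⁻ ry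
    ... | occ-x , free-x | occ-y , free-y =
      ≤-antisym (≮⇒≥ (T-not⁻ free-y ∘ occupied-right occ-x)) (≮⇒≥ (T-not⁻ free-x ∘ occupied-right occ-y))

    rowOfP⁺ : ∀ {x s} → InStrip x → t x ≡ s → T (rowOfP s)
    rowOfP⁺ {x} (j≤x , x<jk) tx = any<⁺ k _ x-j<k (≡⇒≡ᵇ _ _ (trans (cong t (m+[n∸m]≡n j≤x)) tx))
      where
      x-j<k : x ∸ j < k
      x-j<k = subst (x ∸ j <_) (m+n∸m≡n j k) (∸-monoˡ-< x<jk j≤x)

    Tcol⁻ : ∀ {p s a} → a ∈ Tcol p s → a ∈ XY × px a ≡ px p × py a < s
    Tcol⁻ {p} {s} a∈ with ∈-filter⁻ (T? ∘ (λ a → (px a ≡ᵇ px p) ∧ (py a <ᵇ s))) {xs = XY} a∈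
    ... | a∈XY , sat with T-∧⁻ sat
    ...   | same-col , below = a∈XY , ≡ᵇ⇒≡ _ _ same-col , <ᵇ⇒< _ _ below

    Tcol⁺ : ∀ {p s a} → a ∈ XY → px a ≡ px p → py a < s → a ∈ Tcol p s
    Tcol⁺ {p} {s} {a} a∈ same-col below =
      ∈-filter⁺ (T? ∘ (λ a → (px a ≡ᵇ px p) ∧ (py a <ᵇ s))) a∈ (T-∧⁺ (≡⇒≡ᵇ _ _ same-col) (<⇒<ᵇ below))

    ry-ub : ∀ p {s a} → a ∈ XY → px a ≡ px p → py a < s → py a ≤ ry p s
    ry-ub p {s} a∈ same-col below = foldr-⊔-ub py (Tcol p s) (Tcol⁺ {p} a∈ same-col below)

    ry-lub : ∀ p {s m} → (∀ {a} → a ∈ XY → px a ≡ px p → py a < s → py a ≤ m) → ry p s ≤ m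
    ry-lub p {s} ub = foldr-⊔-lub py (Tcol p s) λ a∈ →
      let a∈XY , same-col , below = Tcol⁻ {p} a∈ in ub a∈XY same-col below

    ry-≤ : ∀ p {s} → ry p (suc s) ≤ s
    ry-≤ p = ry-lub p (λ _ _ → ≤-pred)

    ry-new : ∀ p {s} → (px p , s) ∈ XY → ry p (suc s) ≡ s
    ry-new p new = ≤-antisym (ry-≤ p) (ry-ub p new refl ≤-refl)

    ry-old : ∀ p {s} → (px p , s) ∉ XY → ry p (suc s) ≡ ry p s
    ry-old p {s} absent =
      ≤-antisym (ry-lub p below-new) (ry-lub p λ a∈ same-col → ry-ub p a∈ same-col ∘ m<n⇒m<1+n)
      where
      below-new : ∀ {a} → a ∈ XY → px a ≡ px p → py a < suc s → py a ≤ ry p s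
      below-new a∈ same-col a<1+s with m≤n⇒m<n∨m≡n (≤-pred a<1+s)
      ... | inj₁ a<s   = ry-ub p a∈ same-col a<s
      ... | inj₂ a-row = ⊥-elim (absent (subst (_∈ XY) (cong₂ _,_ same-col a-row) a∈))

    hidden-stable : ∀ p {s} → (px p , s) ∉ XY → hidden p (suc s) ≡ hidden p s
    hidden-stable p absent = cong (flanked (px p)) (ry-old p absent)

    Zs-below-top : ∀ p {s q} → (px p , suc s) ∈ XY → q ∈ Zs s → px q ≡ px p → py q ≤ ry p (suc s)
    Zs-below-top p {s} new q∈ same-col =
      ry-ub p (Zs-mono n (<⇒≤ (Zs-py n new)) q∈) same-col (s≤s (Zs-py s q∈))

    top-row⊆Zs : ∀ p {s a} → a ∈ XY → py a ≡ ry p (suc s) → a ∈ Zs s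
    top-row⊆Zs p {s} a∈ a-row = Zs-restrict n a∈ (subst (_≤ s) (sym a-row) (ry-≤ p))

    hidden-newPoint⇒rowOfP : ∀ {p s} → T (hidden p (suc s)) → (px p , suc s) ∈ XY → T (rowOfP (suc s))
    hidden-newPoint⇒rowOfP {p} {s} hid new with T-∧⁻ hid
    ... | left , right with rowHas⁻ left | rowHas⁻ right
    ... | a , a∈ , a-row , (j≤a , _) , a<p | b , b∈ , b-row , (_ , b<jk) , p<b
      with producer-between new (Zs-below-top p new) (top-row⊆Zs p a∈ a-row) (top-row⊆Zs p b∈ b-row)
                            a-row b-row (<ᵇ⇒< _ _ a<p) (<ᵇ⇒< _ _ p<b)
    ... | p′ , p′∈ , a<p′ , p′<b =
      rowOfP⁺ (≤-trans j≤a (<⇒≤ a<p′) , <-trans p′<b b<jk) (proj₂ (rowPts-mem p′∈))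

    unflanked⇒extremal : ∀ {o l r} → T o → ¬ T (l ∧ r) → T (o ∧ not l) ⊎ T (o ∧ not r)
    unflanked⇒extremal {l = false} occ _         = inj₁ (T-∧⁺ occ _)
    unflanked⇒extremal {l = true}  occ ¬flanked  = inj₂ (T-∧⁺ occ (T-not⁺ ¬flanked))

    fall⇒extremal : ∀ {c s} → InStrip c →
      T (hidden (pt c) (suc s)) → ¬ T (hidden (pt c) (suc (suc s))) →
      T (rowOfP (suc s)) × (T (leftmost c (suc s)) ⊎ T (rightmost c (suc s)))
    fall⇒extremal {c} {s} strip hid exposed with (c , suc s) ∈? XY
    ... | no  absent = ⊥-elim (exposed (subst T (sym (hidden-stable (pt c) absent)) hid))
    ... | yes new = hidden-newPoint⇒rowOfP {pt c} hid new ,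
                    unflanked⇒extremal (rowHas⁺ {φ = _≡ᵇ c} new strip (≡⇒≡ᵇ c c refl))
                                (subst (λ r → ¬ T (flanked c r)) (ry-new (pt c) new) exposed)

    extremality : ℕ → ℕ → ℕ
    extremality c s = toℕ (rowOfP s ∧ leftmost c s) + toℕ (rowOfP s ∧ rightmost c s)

    fall≤extremality : ∀ {c} → InStrip c → ∀ s →
      toℕ (hidden (pt c) (suc s) ∧ not (hidden (pt c) (suc (suc s)))) ≤ extremality c (suc s)
    fall≤extremality {c} strip s with hidden (pt c) (suc s) ∧ not (hidden (pt c) (suc (suc s))) in fall
    ... | false = z≤n
    ... | true with T-∧⁻ (Equivalence.from T-≡ fall)
    ...   | hid , exposed with fall⇒extremal strip hid (T-not⁻ exposed)
    ...     | row , inj₁ left  = ≤-trans (T⇒1≤toℕ (T-∧⁺ row left)) (m≤m+n _ _)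
    ...     | row , inj₂ right = ≤-trans (T⇒1≤toℕ (T-∧⁺ row right)) (m≤n+m _ _)

    N≡changes : ∀ p → N p ≡ changes (hidden p) (suc (py p)) (n ∸ py p)
    N≡changes p = trans (cong (length ∘ filterᵇ state-change) (map-applyUpTo id time (n ∸ py p)))
                        (length-filterᵇ-applyUpTo state-change time (n ∸ py p))
      where
      state-change = λ s → hidden p s xor hidden p (suc s)
      time = λ i → suc (py p) + i

    N≤ : ∀ {c} → InStrip c → t c ≤ n → N (pt c) ≤ 2 * ∑[ s < suc n ] extremality c s + 1
    N≤ {c} strip tc≤n = begin
      N (pt c)                                  ≡⟨ N≡changes (pt c) ⟩
      changes (hidden (pt c)) a m               ≤⟨ changes≤2*falls+1 (hidden (pt c)) a m ⟩
      2 * falls (hidden (pt c)) a m + 1         ≤⟨ +-monoˡ-≤ 1 (*-monoʳ-≤ 2 falls≤) ⟩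
      2 * ∑[ s < suc n ] extremality c s + 1    ∎
      where
      open ≤-Reasoning
      a = suc (t c)
      m = n ∸ t c
      falls≤ : falls (hidden (pt c)) a m ≤ ∑[ s < suc n ] extremality c s
      falls≤ = begin
        falls (hidden (pt c)) a m               ≤⟨ ∑-mono-≤ m (λ u _ → fall≤extremality strip (t c + u)) ⟩
        ∑[ u < m ] extremality c (a + u)        ≤⟨ ∑-shift-≤ a m _ ⟩
        ∑ (a + m) (extremality c)               ≡⟨ cong (λ x → ∑ (suc x) (extremality c)) (m+[n∸m]≡n tc≤n) ⟩
        ∑[ s < suc n ] extremality c s          ∎

    row-extremality≤ : ∀ s → ∑[ i < k ] extremality (j + i) s ≤ 2 * toℕ (rowOfP s)
    row-extremality≤ s = begin
      ∑[ i < k ] extremality (j + i) s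
        ≡⟨ ∑-distrib-+ k _ _ ⟩
      ∑[ i < k ] toℕ (rowOfP s ∧ leftmost (j + i) s) + ∑[ i < k ] toℕ (rowOfP s ∧ rightmost (j + i) s)
        ≤⟨ +-mono-≤ (∑-toℕ-∧-≤ k (rowOfP s) (λ i → leftmost (j + i) s)
                       (λ lx ly → +-cancelˡ-≡ j _ _ (leftmost-unique lx ly)))
                    (∑-toℕ-∧-≤ k (rowOfP s) (λ i → rightmost (j + i) s)
                       (λ rx ry → +-cancelˡ-≡ j _ _ (rightmost-unique rx ry))) ⟩
      toℕ (rowOfP s) + toℕ (rowOfP s)
        ≡⟨ cong (toℕ (rowOfP s) +_) (+-identityʳ _) ⟨
      2 * toℕ (rowOfP s) ∎
      where open ≤-Reasoning

    totalN≤5k : (∀ i → i < k → t (j + i) ≤ n) → totalN ≤ 5 * k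
    totalN≤5k t≤n = begin
      totalN                                  ≡⟨ trans (cong sum (map-applyUpTo id _ k)) (sum-applyUpTo _ k) ⟩
      ∑[ i < k ] N (pt (j + i))               ≤⟨ ∑-mono-≤ k (λ i i<k → N≤ (strip i<k) (t≤n i i<k)) ⟩
      ∑[ i < k ] (2 * E i + 1)                ≡⟨ ∑-distrib-+ k _ _ ⟩
      ∑[ i < k ] (2 * E i) + ∑[ _ < k ] 1     ≡⟨ cong₂ _+_ (∑-*ˡ k 2 E) (trans (∑-const k 1) (*-identityʳ k)) ⟩
      2 * ∑ k E + k                           ≤⟨ +-monoˡ-≤ k (*-monoʳ-≤ 2 total-extremality≤) ⟩
      2 * (2 * k) + k                         ≡⟨ arithmetic k ⟩
      5 * k                                   ∎
      where
      open ≤-Reasoning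
      E = λ i → ∑[ s < suc n ] extremality (j + i) s
      strip : ∀ {i} → i < k → InStrip (j + i)
      strip i<k = m≤m+n j _ , +-monoʳ-< j i<k
      total-extremality≤ : ∑ k E ≤ 2 * k
      total-extremality≤ = begin
        ∑ k E                                            ≡⟨ ∑-comm k (suc n) _ ⟩
        ∑[ s < suc n ] ∑[ i < k ] extremality (j + i) s  ≤⟨ ∑-mono-≤ (suc n) (λ s _ → row-extremality≤ s) ⟩
        ∑[ s < suc n ] (2 * toℕ (rowOfP s))              ≡⟨ ∑-*ˡ (suc n) 2 _ ⟩
        2 * ∑[ s < suc n ] toℕ (rowOfP s)                ≤⟨ *-monoʳ-≤ 2 (∑-toℕ-image≤ (suc n) k (t ∘ (j +_))) ⟩
        2 * k                                            ∎
      arithmetic : ∀ k → 2 * (2 * k) + k ≡ 5 * k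
      arithmetic = solve-∀

lemma4 : (n : ℕ) (t : ℕ → ℕ) →
    1 ≤ n →
    (∀ i → 1 ≤ i → i ≤ n → 1 ≤ t i) →
    (∀ i → 1 ≤ i → i ≤ n → t i ≤ n) →
    (∀ i i′ → 1 ≤ i → i ≤ n → 1 ≤ i′ → i′ ≤ n → t i ≡ t i′ → i ≡ i′) →
    (j k : ℕ) → 1 ≤ j → 1 ≤ k → j + 2 * k ∸ 1 ≤ n →
    Greedy.Window.totalN n t j k ≤ 5 * k
lemma4 n t _ _ t≤n _ j k 1≤j _ j+2k-1≤n = GreedyArb.Strip.totalN≤5k n t j k t[P]≤n
  where
  t[P]≤n : ∀ i → i < k → t (j + i) ≤ n
  t[P]≤n i i<k = t≤n (j + i) (≤-trans 1≤j (m≤m+n j i))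
    (≤-trans (∸-monoˡ-≤ 1 (≤-trans (+-monoʳ-< j i<k) (+-monoʳ-≤ j (m≤m+n k (k + 0))))) j+2k-1≤n)
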